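{- Team motion planning with any set of gadgets is in RE (recursively enumerable).
   Context: A gadget consists of finitely many locations and finitely many states; each state $s$ has a set of transitions $(a,b,s')$ meaning a robot may enter at location $a$, exit at location $b$, and the gadget's state becomes $s'$. A system of gadgets consists of copies of gadgets (from the given set), initial states, and a connection graph on locations; a robot moves freely along connection-graph paths and traverses gadgets according to their states. In team motion planning, there are several robots, each controlled by its own player with its own start and goal location, and the players are partitioned into two teams (White and Black); players take turns, each move consisting of their robot traversing a single gadget. All players know the initial configuration, but afterwards each player sees only the states of the gadgets reachable from its own robot via the connection graph. A team wins when any of its robots reaches its goal location. The question is whether the White team has a forced win (strategies for the White players, each depending only on that player's own observations, that win against all Black play). -}

module Defs where

open import Data.Nat using (ℕ; zero; suc)
import Data.Nat
open import Data.Fin using (Fin; zero; suc; _≟_)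
open import Data.Bool using (Bool; true)
open import Data.List using (List; []; _∷_)
open import Data.List.Membership.Propositional using (_∈_)
open import Data.List.Relation.Binary.Pointwise using (Pointwise)
open import Data.Product using (Σ; ∃; _×_; _,_)
open import Data.Sum using (_⊎_)
open import Data.Empty using (⊥)
open import Relation.Nullary using (¬_; yes; no)
open import Relation.Binary.PropositionalEquality using (_≡_; _≢_; refl)
open import Function.Bundles using (_⇔_)

-- A predicate P on a (finitely encodable) type A of problem instances is
-- recursively enumerable iff it has a semi-decision procedure: a total
-- (hence computable, as every --safe Agda function is) test
-- f x n  ("does the search accept x within n steps?") with
-- P x  ⇔  ∃ n . f x n ≡ true.

RE : (A : Set) → (A → Set) → Set
RE A P = Σ (A → ℕ → Bool) λ f → ∀ x → P x ⇔ (∃ λ n → f x n ≡ true)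

-- Gadgets: finitely many locations and states; for each state a finite
-- set (list) of transitions (a , b , s'): enter at a, exit at b, new state s'.

record Gadget : Set where
  field
    nloc  : ℕ
    nst   : ℕ
    trans : Fin nst → List (Fin nloc × Fin nloc × Fin nst)

open Gadget public

data Team : Set where
  white black : Team

LocOf : ∀ {k} → (Fin k → Gadget) → (m : ℕ) → (Fin m → Fin k) → Set
LocOf G m kind = Σ (Fin m) (λ i → Fin (nloc (G (kind i))))

-- The players are Fin (suc lastPlayer) (at least one player); they move
-- in the cyclic order 0, 1, …, lastPlayer, 0, 1, …
record Instance {k : ℕ} (G : Fin k → Gadget) : Set where
  field
    m          : ℕ
    kind       : Fin m → Fin k
    init       : (i : Fin m) → Fin (nst (G (kind i)))
    edges      : List (LocOf G m kind × LocOf G m kind) -- connection graph (undirected)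
    lastPlayer : ℕ
    team       : Fin (suc lastPlayer) → Team
    start      : Fin (suc lastPlayer) → LocOf G m kind
    goal       : Fin (suc lastPlayer) → LocOf G m kind

module Game {k : ℕ} (G : Fin k → Gadget) (I : Instance G) where
  open Instance I

  Player : Set
  Player = Fin (suc lastPlayer)

  Loc : Set
  Loc = LocOf G m kind

  St : Fin m → Set
  St i = Fin (nst (G (kind i)))

  data Reach (x : Loc) : Loc → Set where
    here : Reach x x
    step : ∀ {y z} → Reach x y → ((y , z) ∈ edges ⊎ (z , y) ∈ edges) → Reach x z

  GReach : Loc → Fin m → Set
  GReach x i = Σ (Fin (nloc (G (kind i)))) λ a → Reach x (i , a)

  record Snap : Set where
    constructor snap
    field
      state : (i : Fin m) → St i
      pos   : Player → Loc
  open Snap public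

  Move : Set
  Move = Σ (Fin m) λ i → Fin (nloc (G (kind i))) × Fin (nloc (G (kind i))) × St i

  Legal : Snap → Player → Move → Set
  Legal s j (i , a , b , s') =
    Reach (pos s j) (i , a) × (a , b , s') ∈ trans (G (kind i)) (state s i)

  setState : ((i : Fin m) → St i) → (i : Fin m) → St i → (i' : Fin m) → St i'
  setState f i v i' with i' ≟ i
  ... | yes refl = v
  ... | no _     = f i'

  setPos : (Player → Loc) → Player → Loc → Player → Loc
  setPos f j x j' with j' ≟ j
  ... | yes _ = x
  ... | no _  = f j'

  apply : Snap → Player → Move → Snap
  apply s j (i , a , b , s') = snap (setState (state s) i s') (setPos (pos s) j (i , b))

  NoLegal : Snap → Player → Set
  NoLegal s j = ¬ (Σ Move (Legal s j))

  NotOver : Snap → Set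
  NotOver s = ∀ j → pos s j ≢ goal j

  WhiteWon : Snap → Set
  WhiteWon s = (∃ λ j → team j ≡ white × pos s j ≡ goal j)
             × (∀ j → team j ≡ black → pos s j ≢ goal j)

  -- what player j sees of a snapshot: its own position and the states of
  -- the gadgets reachable from it.  ObsEq j s s' : s, s' look the same to j.
  ObsEq : Player → Snap → Snap → Set
  ObsEq j s s' = pos s j ≡ pos s' j
               × (∀ i → GReach (pos s j) i → state s i ≡ state s' i)

  -- strategies get the history of snapshots (most recent first)
  Strategy : Set
  Strategy = Player → List Snap → Move

  Uniform : Strategy → Set
  Uniform σ = ∀ j h h' → Pointwise (ObsEq j) h h' → σ j h ≡ σ j h'

  record GState : Set where
    constructor gst
    field
      cur  : Player
      now  : Snap
      past : List Snap
  open GState public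

  nextP : Player → Player
  nextP j with Data.Fin.toℕ j Data.Nat.<? lastPlayer
  ... | yes lt = Data.Fin.fromℕ< (Data.Nat.s≤s lt)
  ... | no _   = zero

  advance : GState → Snap → GState
  advance g s = gst (nextP (cur g)) s (now g ∷ past g)

  -- Wins σ g : with White's strategy profile σ, from game state g White
  -- wins against every possible Black play (all plays are finite and end
  -- in a White win).  A player with no legal move passes.
  data Wins (σ : Strategy) : GState → Set where
    won   : ∀ {g} → WhiteWon (now g) → Wins σ g
    wmove : ∀ {g} → NotOver (now g) → team (cur g) ≡ white →
            Legal (now g) (cur g) (σ (cur g) (now g ∷ past g)) →
            Wins σ (advance g (apply (now g) (cur g) (σ (cur g) (now g ∷ past g)))) →
            Wins σ g
    wpass : ∀ {g} → NotOver (now g) → team (cur g) ≡ white →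
            NoLegal (now g) (cur g) → Wins σ (advance g (now g)) → Wins σ g
    bturn : ∀ {g} → NotOver (now g) → team (cur g) ≡ black →
            (∀ mv → Legal (now g) (cur g) mv → Wins σ (advance g (apply (now g) (cur g) mv))) →
            (NoLegal (now g) (cur g) → Wins σ (advance g (now g))) →
            Wins σ g

  initial : GState
  initial = gst zero (snap init start) []

WhiteForcedWin : ∀ {k} (G : Fin k → Gadget) → Instance G → Set
WhiteForcedWin G I = Σ Strategy λ σ → Uniform σ × Wins σ initial
  where open Game G I

{-# OPTIONS --safe #-}
module Submission where

-- A winning derivation for White is a finite tree: every node has finitely many legal
-- moves.  So it consults White's strategy at finitely many histories only, and since the
-- strategy is uniform its values there can be stored in a finite table keyed by what the
-- moving player observes.  The strategy read off such a table is uniform by construction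
-- and still wins, within some number n of rounds.  Conversely, winning within n rounds is
-- decidable, because every quantifier in it ranges over a finite set.  Pairs (n, table)
-- can be enumerated, so searching them for one that wins semi-decides the problem.

open import Defs hiding (trans)
open import Data.Bool using (Bool; true; if_then_else_)
open import Data.Bool.Properties using (T-≡)
open import Data.Empty using (⊥; ⊥-elim)
open import Data.Fin using (Fin; zero; suc; toℕ; _≟_)
open import Data.Fin.Properties using (any?; all?; toℕ-injective)
open import Data.List using (List; []; _∷_; map; concatMap; _++_; allFin; length)
import Data.List.Properties as Listₚ
open import Data.List.Membership.Propositional using (_∈_; lose)
open import Data.List.Membership.Propositional.Properties
  using (∈-map⁺; ∈-++⁺ˡ; ∈-++⁺ʳ; ∈-allFin; ∈-concatMap⁺)
open import Data.List.Relation.Unary.All as All using (All; []; _∷_)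
open import Data.List.Relation.Unary.Any as Any using (here; there)
open import Data.List.Relation.Binary.Pointwise as Pointwise
  using (Pointwise; Pointwise-≡⇒≡; ≡⇒Pointwise-≡)
open import Data.Maybe using (Maybe; just; nothing; fromMaybe)
open import Data.Nat as ℕ using (ℕ; zero; suc; _+_; _≤_; _⊔_; z≤n; s≤s)
open import Data.Nat.Properties using (+-suc; +-identityʳ; m≤m⊔n; m≤n⊔m; suc-injective)
open import Data.Product as Product using (Σ; ∃; _×_; _,_; proj₁; proj₂; uncurry; <_,_>)
import Data.Product.Properties as Productₚ
open import Data.Sum as Sum using (_⊎_; inj₁; inj₂; [_,_]′)
open import Data.Vec as Vec using (Vec; []; _∷_; tabulate; toList; fromList)
import Data.Vec.Properties as Vecₚ
open import Function using (id; _∘_)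
open import Function.Bundles using (_⇔_; mk⇔; Equivalence)
open import Function.Definitions using (StrictlySurjective)
open import Relation.Binary.Definitions using (DecidableEquality)
open import Relation.Binary.PropositionalEquality
  using (_≡_; refl; sym; trans; cong; module ≡-Reasoning)
open import Relation.Nullary using (Dec; yes; no; does)
open import Relation.Nullary.Decidable
  using (_×-dec_; _⊎-dec_; _→-dec_; ¬?; map′; ⌊_⌋; toWitness; fromWitness)
open import Relation.Unary using (Decidable)

Enumeration : Set → Set
Enumeration A = Σ (ℕ → A) (StrictlySurjective _≡_)

-- Cantor's zig-zag: the diagonal a + b = d is walked from (d , 0) down to (0 , d).
zigzag : ℕ × ℕ → ℕ × ℕ
zigzag (zero  , b) = suc b , zero
zigzag (suc a , b) = a , suc b

unpair : ℕ → ℕ × ℕ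
unpair zero    = 0 , 0
unpair (suc n) = zigzag (unpair n)

unpair-walk : ∀ k n {a b} → unpair n ≡ (k + a , b) → unpair (k + n) ≡ (a , k + b)
unpair-walk zero    _         eq = eq
unpair-walk (suc k) n {a} {b} eq =
  cong zigzag (unpair-walk k n (trans eq (cong (_, b) (sym (+-suc k a)))))

unpair-axis : ∀ d → ∃ λ n → unpair n ≡ (d , 0)
unpair-axis zero = 0 , refl
unpair-axis (suc d) with n , eq ← unpair-axis d = suc (d + n) , cong zigzag diagonal-end
  where
  open ≡-Reasoning
  diagonal-end : unpair (d + n) ≡ (0 , d)
  diagonal-end = begin
    unpair (d + n) ≡⟨ unpair-walk d n (trans eq (cong (_, 0) (sym (+-identityʳ d)))) ⟩
    (0 , d + 0)    ≡⟨ cong (0 ,_) (+-identityʳ d) ⟩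
    (0 , d)        ∎

unpair-surjective : StrictlySurjective _≡_ unpair
unpair-surjective (a , b) with n , eq ← unpair-axis (b + a) =
  b + n , trans (unpair-walk b n eq) (cong (a ,_) (+-identityʳ b))

enum-ℕ : Enumeration ℕ
enum-ℕ = id , λ n → n , refl

enum-map : {A B : Set} (f : A → B) → StrictlySurjective _≡_ f → Enumeration A → Enumeration B
enum-map f f-surj (e , e-surj) = f ∘ e , λ y →
  let x , fx≡y = f-surj y
      n , en≡x = e-surj x
  in  n , trans (cong f en≡x) fx≡y

enum-Σ : {A : Set} {B : A → Set} →
         Enumeration A → (∀ a → Enumeration (B a)) → Enumeration (Σ A B)
enum-Σ {A} {B} (e , e-surj) enum-B = enum-map pair pair-surjective (unpair , unpair-surjective)
  where
  pair : ℕ × ℕ → Σ A B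
  pair (i , j) = e i , proj₁ (enum-B (e i)) j

  pair-surjective : StrictlySurjective _≡_ pair
  pair-surjective (a , b) with i , refl ← e-surj a with j , refl ← proj₂ (enum-B (e i)) b =
    (i , j) , refl

enum-× : {A B : Set} → Enumeration A → Enumeration B → Enumeration (A × B)
enum-× enum-A enum-B = enum-Σ enum-A (λ _ → enum-B)

enum-Vec : {A : Set} → Enumeration A → ∀ n → Enumeration (Vec A n)
enum-Vec _ zero    = (λ _ → []) , λ { [] → 0 , refl }
enum-Vec e (suc n) =
  enum-map (uncurry _∷_) (λ { (x ∷ xs) → (x , xs) , refl }) (enum-× e (enum-Vec e n))

enum-List : {A : Set} → Enumeration A → Enumeration (List A)
enum-List e =
  enum-map (toList ∘ proj₂) (λ xs → (length xs , fromList xs) , Vecₚ.toList∘fromList xs)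
           (enum-Σ enum-ℕ (enum-Vec e))

Listing : Set → Set
Listing A = Σ (List A) λ xs → ∀ x → x ∈ xs

listing-Fin : ∀ n → Listing (Fin n)
listing-Fin n = allFin n , ∈-allFin

listing-Σ : {A : Set} {B : A → Set} → Listing A → (∀ a → Listing (B a)) → Listing (Σ A B)
listing-Σ {A} {B} (as , ∈as) listing-B =
  concatMap fibre as ,
  λ (a , b) → ∈-concatMap⁺ fibre (lose (∈as a) (∈-map⁺ (a ,_) (proj₂ (listing-B a) b)))
  where
  fibre : (a : A) → List (Σ A B)
  fibre a = map (a ,_) (proj₁ (listing-B a))

listing-× : {A B : Set} → Listing A → Listing B → Listing (A × B)
listing-× listing-A listing-B = listing-Σ listing-A (λ _ → listing-B)

nth : {A : Set} → A → List A → ℕ → A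
nth d []       _       = d
nth d (x ∷ _)  zero    = x
nth d (_ ∷ xs) (suc n) = nth d xs n

nth-index : {A : Set} (d : A) {x : A} {xs : List A} → x ∈ xs → ∃ λ n → nth d xs n ≡ x
nth-index d (here refl) = 0 , refl
nth-index d (there x∈)  with n , eq ← nth-index d x∈ = suc n , eq

enum-listing : {A : Set} → A → Listing A → Enumeration A
enum-listing d (xs , ∈xs) = nth d xs , λ x → nth-index d (∈xs x)

∀?-listing : {A : Set} {P : A → Set} → Listing A → Decidable P → Dec (∀ a → P a)
∀?-listing (xs , ∈xs) P? =
  map′ (λ all a → All.lookup all (∈xs a)) (λ ∀P → All.tabulate (λ {a} _ → ∀P a)) (All.all? P? xs)

∃?-listing : {A : Set} {P : A → Set} → Listing A → Decidable P → Dec (∃ P)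
∃?-listing (xs , ∈xs) P? = map′ Any.satisfied (λ (a , pa) → lose (∈xs a) pa) (Any.any? P? xs)

Increasing : (ℕ → Set) → Set
Increasing P = ∀ {m n} → m ≤ n → P m → P n

bound-listing : {A : Set} {P : A → ℕ → Set} → Listing A → (∀ a → Increasing (P a)) →
                (∀ a → ∃ (P a)) → ∃ λ n → ∀ a → P a n
bound-listing {P = P} (xs , ∈xs) mono witness =
  Product.map₂ (λ all a → All.lookup all (∈xs a)) (bound xs)
  where
  bound : ∀ ys → ∃ λ n → All (λ a → P a n) ys
  bound []       = 0 , []
  bound (y ∷ ys) with n₁ , p₁ ← witness y | n₂ , p₂ ← bound ys =
    n₁ ⊔ n₂ , mono y (m≤m⊔n n₁ n₂) p₁ ∷ All.map (λ {a} → mono a (m≤n⊔m n₁ n₂)) p₂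

hoist-∃ : {A : Set} {P : ℕ → Set} → Dec A → (A → ∃ P) → ∃ λ n → A → P n
hoist-∃ (yes a) f = Product.map₂ (λ p _ → p) (f a)
hoist-∃ (no ¬a) _ = 0 , λ a → ⊥-elim (¬a a)

onlyIf : {A B : Set} → Dec A → (A → List B) → List B
onlyIf (yes a) f = f a
onlyIf (no _)  _ = []

certificates⇒RE : {A : Set} {P : A → Set} {C : A → Set} (Accepts : ∀ x → C x → Set) →
                  (∀ x → Enumeration (C x)) → (∀ x c → Dec (Accepts x c)) →
                  (∀ x → P x ⇔ ∃ (Accepts x)) → RE A P
certificates⇒RE {A} {P} Accepts enum Accepts? P⇔ = search , λ x → mk⇔ (found x) (sound x)
  where
  search : A → ℕ → Bool
  search x n = ⌊ Accepts? x (proj₁ (enum x) n) ⌋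

  found : ∀ x → P x → ∃ λ n → search x n ≡ true
  found x p with c , acc ← Equivalence.to (P⇔ x) p with n , refl ← proj₂ (enum x) c =
    n , Equivalence.to T-≡ (fromWitness acc)

  sound : ∀ x → (∃ λ n → search x n ≡ true) → P x
  sound x (n , accepted) =
    Equivalence.from (P⇔ x) (_ , toWitness (Equivalence.from T-≡ accepted))

module _ {K V : Set} (_≟ₖ_ : DecidableEquality K) where

  lookup : List (K × V) → K → Maybe V
  lookup []             _ = nothing
  lookup ((k′ , v) ∷ t) k = if does (k′ ≟ₖ k) then just v else lookup t k

  lookup-memo : {Q : Set} (key : Q → K) (val : Q → V) →
                (∀ {q q′} → key q ≡ key q′ → val q ≡ val q′) →
                ∀ {q qs} → q ∈ qs → lookup (map < key , val > qs) (key q) ≡ just (val q)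
  lookup-memo key val resp {q} {q′ ∷ qs} q∈ with key q′ ≟ₖ key q | q∈
  ... | yes eq | _          = cong just (resp eq)
  ... | no neq | here refl  = ⊥-elim (neq refl)
  ... | no _   | there q∈qs = lookup-memo key val resp q∈qs

module Undirected {L : Set} (_≟ₗ_ : DecidableEquality L) where

  Edges : Set
  Edges = List (L × L)

  Adjacent : Edges → L → L → Set
  Adjacent E y z = (y , z) ∈ E ⊎ (z , y) ∈ E

  data Path (E : Edges) (x : L) : L → Set where
    here : Path E x x
    step : ∀ {y z} → Path E x y → Adjacent E y z → Path E x z

  path-++ : ∀ {E x y z} → Path E x y → Path E y z → Path E x z
  path-++ p here       = p
  path-++ p (step q a) = step (path-++ p q) a

  path-mono : ∀ {E E′ x y} → (∀ {e} → e ∈ E → e ∈ E′) → Path E x y → Path E′ x y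
  path-mono _    here              = here
  path-mono E⊆E′ (step p (inj₁ a)) = step (path-mono E⊆E′ p) (inj₁ (E⊆E′ a))
  path-mono E⊆E′ (step p (inj₂ a)) = step (path-mono E⊆E′ p) (inj₂ (E⊆E′ a))

  path-[] : ∀ {x y} → Path [] x y → x ≡ y
  path-[] here              = refl
  path-[] (step _ (inj₁ ()))
  path-[] (step _ (inj₂ ()))

  Through : Edges → L × L → L → L → Set
  Through E (u , v) x y = (Path E x u ⊎ Path E x v) × (Path E u y ⊎ Path E v y)

  extend : ∀ {E e x y z} → Path E x y ⊎ Through E e x y → Adjacent E y z →
           Path E x z ⊎ Through E e x z
  extend (inj₁ p)       a = inj₁ (step p a)
  extend (inj₂ (s , t)) a = inj₂ (s , Sum.map (λ q → step q a) (λ q → step q a) t)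

  path-∷⁻ : ∀ {E u v x y} → Path ((u , v) ∷ E) x y → Path E x y ⊎ Through E (u , v) x y
  path-∷⁻ here                        = inj₁ here
  path-∷⁻ (step p (inj₁ (here refl))) = inj₂ ([ inj₁ , proj₁ ]′ (path-∷⁻ p) , inj₂ here)
  path-∷⁻ (step p (inj₂ (here refl))) = inj₂ ([ inj₂ , proj₁ ]′ (path-∷⁻ p) , inj₁ here)
  path-∷⁻ (step p (inj₁ (there a)))   = extend (path-∷⁻ p) (inj₁ a)
  path-∷⁻ (step p (inj₂ (there a)))   = extend (path-∷⁻ p) (inj₂ a)

  path-∷⁺ : ∀ {E u v x y} → Path E x y ⊎ Through E (u , v) x y → Path ((u , v) ∷ E) x y
  path-∷⁺ (inj₁ p) = path-mono there p
  path-∷⁺ {E} {u} {v} (inj₂ (s , t)) =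
    path-++ ([ weaken , (λ p → step (weaken p) v→u) ]′ s)
            ([ weaken , (λ p → path-++ (step here u→v) (weaken p)) ]′ t)
    where
    weaken : ∀ {x y} → Path E x y → Path ((u , v) ∷ E) x y
    weaken = path-mono there
    u→v : Adjacent ((u , v) ∷ E) u v
    u→v = inj₁ (here refl)
    v→u : Adjacent ((u , v) ∷ E) v u
    v→u = inj₂ (here refl)

  path? : ∀ E x y → Dec (Path E x y)
  path? []            x y = map′ (λ { refl → here }) path-[] (x ≟ₗ y)
  path? ((u , v) ∷ E) x y = map′ path-∷⁺ path-∷⁻
    (path? E x y ⊎-dec ((path? E x u ⊎-dec path? E x v) ×-dec (path? E u y ⊎-dec path? E v y)))

_≟ᵗ_ : DecidableEquality Team
white ≟ᵗ white = yes refl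
white ≟ᵗ black = no λ ()
black ≟ᵗ white = no λ ()
black ≟ᵗ black = yes refl

tabulate-injective : ∀ {A : Set} {n} {f g : Fin n → A} → tabulate f ≡ tabulate g → ∀ i → f i ≡ g i
tabulate-injective {f = f} {g} eq i = begin
  f i                       ≡⟨ Vecₚ.lookup∘tabulate f i ⟨
  Vec.lookup (tabulate f) i ≡⟨ cong (λ v → Vec.lookup v i) eq ⟩
  Vec.lookup (tabulate g) i ≡⟨ Vecₚ.lookup∘tabulate g i ⟩
  g i                       ∎
  where open ≡-Reasoning

module _ {k} (G : Fin k → Gadget) (I : Instance G) where
  open Instance I
  open Game G I

  _≟ₗ_ : DecidableEquality Loc
  _≟ₗ_ = Productₚ.≡-dec _≟_ _≟_

  open Undirected _≟ₗ_ using (Path; here; step; path?)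

  Reach? : ∀ x y → Dec (Reach x y)
  Reach? x y = map′ fromPath toPath (path? edges x y)
    where
    fromPath : ∀ {y} → Path edges x y → Reach x y
    fromPath here       = here
    fromPath (step p a) = step (fromPath p) a
    toPath : ∀ {y} → Reach x y → Path edges x y
    toPath here       = here
    toPath (step r a) = step (toPath r) a

  GReach? : ∀ x i → Dec (GReach x i)
  GReach? x i = any? λ a → Reach? x (i , a)

  locations : Listing Loc
  locations = listing-Σ (listing-Fin m) (λ i → listing-Fin _)

  moves : Listing Move
  moves = listing-Σ (listing-Fin m) λ i →
    listing-× (listing-Fin _) (listing-× (listing-Fin _) (listing-Fin _))

  Legal? : ∀ s j mv → Dec (Legal s j mv)
  Legal? s j (i , a , b , s′) =
    Reach? (pos s j) (i , a) ×-dec (a , b , s′) ∈? Gadget.trans (G (kind i)) (state s i)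
    where
    open import Data.List.Membership.DecPropositional
      (Productₚ.≡-dec _≟_ (Productₚ.≡-dec _≟_ _≟_)) using (_∈?_)

  NoLegal? : ∀ s j → Dec (NoLegal s j)
  NoLegal? s j = ¬? (∃?-listing moves (Legal? s j))

  NotOver? : ∀ s → Dec (NotOver s)
  NotOver? s = all? λ j → ¬? (pos s j ≟ₗ goal j)

  WhiteWon? : ∀ s → Dec (WhiteWon s)
  WhiteWon? s = any? (λ j → (team j ≟ᵗ white) ×-dec (pos s j ≟ₗ goal j))
         ×-dec all? (λ j → (team j ≟ᵗ black) →-dec ¬? (pos s j ≟ₗ goal j))

  -- 0 marks a gadget that is not reachable from x; a visible state s is recorded as 1 + s.
  visible : Loc → ((i : Fin m) → St i) → Fin m → ℕ
  visible x st i with GReach? x i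
  ... | yes _ = suc (toℕ (st i))
  ... | no _  = 0

  visible-cong : ∀ {x st st′} → (∀ i → GReach x i → st i ≡ st′ i) →
                 ∀ i → visible x st i ≡ visible x st′ i
  visible-cong {x} same i with GReach? x i
  ... | yes g = cong (suc ∘ toℕ) (same i g)
  ... | no _  = refl

  visible-injective : ∀ {x st st′ i} → GReach x i →
                      visible x st i ≡ visible x st′ i → st i ≡ st′ i
  visible-injective {x} {i = i} g eq with GReach? x i
  ... | yes _ = toℕ-injective (suc-injective eq)
  ... | no ¬g = ⊥-elim (¬g g)

  Observation : Set
  Observation = Loc × Vec ℕ m

  observation : Loc → ((i : Fin m) → St i) → Observation
  observation x st = x , tabulate (visible x st)

  observation-injective : ∀ {x x′ st st′} → observation x st ≡ observation x′ st′ →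
                          x ≡ x′ × (∀ i → GReach x i → st i ≡ st′ i)
  observation-injective eq with refl ← Productₚ.,-injectiveˡ eq =
    refl , λ i g → visible-injective g (tabulate-injective (Productₚ.,-injectiveʳ eq) i)

  observe : Player → Snap → Observation
  observe j s = observation (pos s j) (state s)

  observe-≡⇔ObsEq : ∀ {j s s′} → observe j s ≡ observe j s′ ⇔ ObsEq j s s′
  observe-≡⇔ObsEq {j} {s} {s′} = mk⇔ observation-injective λ (same-pos , same-state) →
    trans (cong (_ ,_) (Vecₚ.tabulate-cong (visible-cong same-state)))
          (cong (λ x → observation x (state s′)) same-pos)

  observations : Player → List Snap → List Observation
  observations j = map (observe j)

  observations-≡⇔ : ∀ {j h h′} → observations j h ≡ observations j h′ ⇔ Pointwise (ObsEq j) h h′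
  observations-≡⇔ {j} = mk⇔
    (λ eq → Pointwise.map (λ {s s′} → Equivalence.to (observe-≡⇔ObsEq {j} {s} {s′}))
                          (Pointwise.map⁻ (observe j) (observe j) (≡⇒Pointwise-≡ eq)))
    (λ same → Pointwise-≡⇒≡ (Pointwise.map⁺ (observe j) (observe j)
                (Pointwise.map (λ {s s′} → Equivalence.from (observe-≡⇔ObsEq {j} {s} {s′})) same)))

  Key : Set
  Key = Player × List Observation

  _≟ₖ_ : DecidableEquality Key
  _≟ₖ_ = Productₚ.≡-dec _≟_ (Listₚ.≡-dec (Productₚ.≡-dec _≟ₗ_ (Vecₚ.≡-dec ℕ._≟_)))

  key : Player → List Snap → Key
  key j h = j , observations j h

  Table : Set
  Table = List (Key × Move)

  -- Played on histories missing from the table; any move would do.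
  defaultMove : Move
  defaultMove = proj₁ (start zero) , proj₂ (start zero) , proj₂ (start zero) , init (proj₁ (start zero))

  tableStrategy : Table → Strategy
  tableStrategy t j h = fromMaybe defaultMove (lookup _≟ₖ_ t (key j h))

  tableStrategy-uniform : ∀ t → Uniform (tableStrategy t)
  tableStrategy-uniform t j h h′ same =
    cong (λ o → fromMaybe defaultMove (lookup _≟ₖ_ t (j , o))) (Equivalence.from observations-≡⇔ same)

  uniform-key : ∀ {σ} → Uniform σ →
                ∀ {q q′} → uncurry key q ≡ uncurry key q′ → uncurry σ q ≡ uncurry σ q′
  uniform-key U {j , h} {j′ , h′} eq with refl ← Productₚ.,-injectiveˡ eq =
    U j h h′ (Equivalence.to observations-≡⇔ (Productₚ.,-injectiveʳ eq))

  memoTable : Strategy → List (Player × List Snap) → Table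
  memoTable σ qs = map < uncurry key , uncurry σ > qs

  Agrees : Strategy → Strategy → List (Player × List Snap) → Set
  Agrees τ σ qs = ∀ {j h} → (j , h) ∈ qs → τ j h ≡ σ j h

  memoTable-agrees : ∀ {σ} → Uniform σ → ∀ qs → Agrees (tableStrategy (memoTable σ qs)) σ qs
  memoTable-agrees {σ} U qs q∈
    rewrite lookup-memo _≟ₖ_ (uncurry key) (uncurry σ) (uniform-key U) q∈ = refl

  after : GState → Move → GState
  after g mv = advance g (apply (now g) (cur g) mv)

  pass : GState → GState
  pass g = advance g (now g)

  module _ (σ : Strategy) where

    σ-move : GState → Move
    σ-move g = σ (cur g) (now g ∷ past g)

    WhiteTurn : (GState → Set) → GState → Set
    WhiteTurn X g = (Legal (now g) (cur g) (σ-move g) × X (after g (σ-move g)))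
                  ⊎ (NoLegal (now g) (cur g) × X (pass g))

    BlackTurn : (GState → Set) → GState → Set
    BlackTurn X g = (∀ mv → Legal (now g) (cur g) mv → X (after g mv))
                  × (NoLegal (now g) (cur g) → X (pass g))

    Round : (GState → Set) → GState → Set
    Round X g = WhiteWon (now g)
              ⊎ (NotOver (now g) × ((team (cur g) ≡ white × WhiteTurn X g)
                                   ⊎ (team (cur g) ≡ black × BlackTurn X g)))

    WinsWithin : ℕ → GState → Set
    WinsWithin zero    _ = ⊥
    WinsWithin (suc n) g = Round (WinsWithin n) g

    Round-mono : ∀ {X Y : GState → Set} → (∀ {g} → X g → Y g) → ∀ {g} → Round X g → Round Y g
    Round-mono f (inj₁ w)                                 = inj₁ w
    Round-mono f (inj₂ (¬o , inj₁ (tw , inj₁ (l , x))))   = inj₂ (¬o , inj₁ (tw , inj₁ (l , f x)))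
    Round-mono f (inj₂ (¬o , inj₁ (tw , inj₂ (nl , x))))  = inj₂ (¬o , inj₁ (tw , inj₂ (nl , f x)))
    Round-mono f (inj₂ (¬o , inj₂ (tb , moved , passed))) =
      inj₂ (¬o , inj₂ (tb , (λ mv l → f (moved mv l)) , f ∘ passed))

    Round-sound : ∀ {X : GState → Set} → (∀ {g} → X g → Wins σ g) → ∀ {g} → Round X g → Wins σ g
    Round-sound f (inj₁ w)                                 = won w
    Round-sound f (inj₂ (¬o , inj₁ (tw , inj₁ (l , x))))   = wmove ¬o tw l (f x)
    Round-sound f (inj₂ (¬o , inj₁ (tw , inj₂ (nl , x))))  = wpass ¬o tw nl (f x)
    Round-sound f (inj₂ (¬o , inj₂ (tb , moved , passed))) =
      bturn ¬o tb (λ mv l → f (moved mv l)) (f ∘ passed)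

    Round? : ∀ {X : GState → Set} → (∀ g → Dec (X g)) → ∀ g → Dec (Round X g)
    Round? X? g = WhiteWon? (now g) ⊎-dec (NotOver? (now g) ×-dec (
        ((team (cur g) ≟ᵗ white) ×-dec
          ((Legal? (now g) (cur g) (σ-move g) ×-dec X? (after g (σ-move g)))
           ⊎-dec (NoLegal? (now g) (cur g) ×-dec X? (pass g))))
      ⊎-dec ((team (cur g) ≟ᵗ black) ×-dec
          (∀?-listing moves (λ mv → Legal? (now g) (cur g) mv →-dec X? (after g mv))
           ×-dec (NoLegal? (now g) (cur g) →-dec X? (pass g))))))

    WinsWithin-mono : ∀ {g} → Increasing (λ n → WinsWithin n g)
    WinsWithin-mono z≤n       ()
    WinsWithin-mono (s≤s m≤n) w = Round-mono (λ {g} → WinsWithin-mono {g} m≤n) w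

    WinsWithin-sound : ∀ n {g} → WinsWithin n g → Wins σ g
    WinsWithin-sound (suc n) = Round-sound (WinsWithin-sound n)

    WinsWithin? : ∀ n g → Dec (WinsWithin n g)
    WinsWithin? zero    _ = no λ ()
    WinsWithin? (suc n) g = Round? (WinsWithin? n) g

    WinsWithin-complete : ∀ {g} → Wins σ g → ∃ λ n → WinsWithin n g
    WinsWithin-complete (won w) = 1 , inj₁ w
    WinsWithin-complete (wmove ¬o tw l d) with n , w ← WinsWithin-complete d =
      suc n , inj₂ (¬o , inj₁ (tw , inj₁ (l , w)))
    WinsWithin-complete (wpass ¬o tw nl d) with n , w ← WinsWithin-complete d =
      suc n , inj₂ (¬o , inj₁ (tw , inj₂ (nl , w)))
    WinsWithin-complete {g} (bturn ¬o tb moved passed)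
      with n₁ , moved′  ← bound-listing moves (λ mv m≤n w l → WinsWithin-mono m≤n (w l))
                            (λ mv → hoist-∃ (Legal? (now g) (cur g) mv)
                                            (λ l → WinsWithin-complete (moved mv l)))
         | n₂ , passed′ ← hoist-∃ (NoLegal? (now g) (cur g)) (λ nl → WinsWithin-complete (passed nl)) =
      suc (n₁ ⊔ n₂) , inj₂ (¬o , inj₂ (tb , (λ mv l → WinsWithin-mono (m≤m⊔n n₁ n₂) (moved′ mv l))
                                           , λ nl → WinsWithin-mono (m≤n⊔m n₁ n₂) (passed′ nl)))

  -- Legality proofs need not be unique, so at a Black node only the branch for the proof
  -- returned by Legal? is recorded (and transferred below).
  queries : ∀ {σ g} → Wins σ g → List (Player × List Snap)
  queries         (won _)                  = []
  queries {g = g} (wmove _ _ _ d)          = (cur g , now g ∷ past g) ∷ queries d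
  queries         (wpass _ _ _ d)          = queries d
  queries {g = g} (bturn _ _ moved passed) =
    concatMap (λ mv → onlyIf (Legal? (now g) (cur g) mv) (λ l → queries (moved mv l))) (proj₁ moves)
    ++ onlyIf (NoLegal? (now g) (cur g)) (λ nl → queries (passed nl))

  wmove-≡ : ∀ {τ g mv} → σ-move τ g ≡ mv → NotOver (now g) → team (cur g) ≡ white →
            Legal (now g) (cur g) mv → Wins τ (after g mv) → Wins τ g
  wmove-≡ refl = wmove

  Wins-transfer : ∀ {σ τ g} (d : Wins σ g) → Agrees τ σ (queries d) → Wins τ g
  onlyIf-transfer : ∀ {σ τ g} {A : Set} (a? : Dec A) (d : A → Wins σ g) →
                    Agrees τ σ (onlyIf a? (λ a → queries (d a))) → A → Wins τ g

  Wins-transfer (won w)            agree = won w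
  Wins-transfer (wmove ¬o tw l d)  agree =
    wmove-≡ (agree (here refl)) ¬o tw l (Wins-transfer d (agree ∘ there))
  Wins-transfer (wpass ¬o tw nl d) agree = wpass ¬o tw nl (Wins-transfer d agree)
  Wins-transfer {g = g} (bturn ¬o tb moved passed) agree = bturn ¬o tb
    (λ mv → onlyIf-transfer (Legal? (now g) (cur g) mv) (moved mv)
              (λ q∈ → agree (∈-++⁺ˡ (∈-concatMap⁺ branch (lose (proj₂ moves mv) q∈)))))
    (onlyIf-transfer (NoLegal? (now g) (cur g)) passed
       (λ q∈ → agree (∈-++⁺ʳ (concatMap branch (proj₁ moves)) q∈)))
    where
    branch : Move → List (Player × List Snap)
    branch mv = onlyIf (Legal? (now g) (cur g) mv) (λ l → queries (moved mv l))

  onlyIf-transfer (yes a) d agree _ = Wins-transfer (d a) agree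
  onlyIf-transfer (no ¬a) _ _     a = ⊥-elim (¬a a)

  Certificate : Set
  Certificate = ℕ × Table

  Accepts : Certificate → Set
  Accepts (n , t) = WinsWithin (tableStrategy t) n initial

  Accepts? : ∀ c → Dec (Accepts c)
  Accepts? (n , t) = WinsWithin? (tableStrategy t) n initial

  whiteForcedWin⇔certificate : WhiteForcedWin G I ⇔ ∃ Accepts
  whiteForcedWin⇔certificate = mk⇔ certify check
    where
    certify : WhiteForcedWin G I → ∃ Accepts
    certify (σ , U , w)
      with n , w′ ← WinsWithin-complete _ (Wins-transfer w (memoTable-agrees U (queries w))) =
      (n , memoTable σ (queries w)) , w′
    check : ∃ Accepts → WhiteForcedWin G I
    check ((n , t) , w) = tableStrategy t , tableStrategy-uniform t , WinsWithin-sound _ n w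

  enum-Certificate : Enumeration Certificate
  enum-Certificate = enum-× enum-ℕ (enum-List (enum-× enum-Key enum-Move))
    where
    enum-Key : Enumeration Key
    enum-Key = enum-× (enum-listing zero (listing-Fin _))
                      (enum-List (enum-× (enum-listing (start zero) locations) (enum-Vec enum-ℕ m)))
    enum-Move : Enumeration Move
    enum-Move = enum-listing defaultMove moves

lemma4p1 : ∀ {k : ℕ} (G : Fin k → Gadget) → RE (Instance G) (WhiteForcedWin G)
lemma4p1 G =
  certificates⇒RE (Accepts G) (enum-Certificate G) (Accepts? G) (whiteForcedWin⇔certificate G)
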